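{- Let $A_1,\dots,A_N$ be finite nonempty subsets of $\mathbb{Z}$, identified with their indicator functions, and let $A_i^{\#}=\{0,1,\dots,|A_i|-1\}$ (also identified with its indicator function). Then $$A_1\star A_2\star\cdots\star A_N \prec A_1^{\#}\star A_2^{\#}\star\cdots\star A_N^{\#},$$ where $\star$ denotes convolution on $\mathbb{Z}$, $(f\star g)(k)=\sum_{i\in\mathbb{Z}}f(i)g(k-i)$.
   Context: Majorization: for finitely supported $f,g:\mathbb{Z}\to\mathbb{R}_+$, let $f^{[i]}$ denote the $i$-th largest value of $f$ (counted with multiplicity, values outside the support being $0$). Then $f\prec g$ means $\sum_{i=1}^k f^{[i]}\le\sum_{i=1}^k g^{[i]}$ for every $k\ge1$, and $\sum_i f^{[i]}=\sum_i g^{[i]}$. -}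

module Defs where

open import Data.Nat as ℕ using (ℕ; zero; suc)
import Data.Nat.Properties as ℕP
open import Data.Integer as ℤ using (ℤ; +_; _-_)
import Data.Integer.Properties as ℤP
open import Data.Nat.ListAction using (sum)
open import Data.List using (List; []; _∷_; map; take; reverse; length; upTo; deduplicate; cartesianProductWith)
open import Data.List.Membership.Propositional using (_∈_; _∉_)
open import Data.List.Membership.Propositional.Properties
  using (∈-deduplicate⁺; ∈-deduplicate⁻; ∈-cartesianProductWith⁺)
open import Data.List.Membership.DecPropositional ℤ._≟_ using (_∈?_)
open import Data.List.Relation.Unary.Any using (here; there)
open import Data.Fin using (Fin)
open import Data.Vec.Functional using (foldr)
open import Data.Product using (Σ; _×_; _,_)
open import Relation.Nullary using (¬_; yes; no)
open import Relation.Binary.PropositionalEquality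
open import Data.List.Sort ℕP.≤-decTotalOrder using (sort)

-- Finitely supported functions ℤ → ℕ (values in ℕ ⊂ ℝ₊).
-- 'supp' is a finite list covering every point where 'fn' is nonzero.

record FinSupp : Set where
  field
    fn     : ℤ → ℕ
    supp   : List ℤ
    covers : ∀ k → ¬ (fn k ≡ 0) → k ∈ supp
open FinSupp public

usupp : FinSupp → List ℤ
usupp f = deduplicate ℤ._≟_ (supp f)

private
  sum≢0 : ∀ (h : ℤ → ℕ) xs → ¬ (sum (map h xs) ≡ 0) → Σ ℤ λ x → x ∈ xs × ¬ (h x ≡ 0)
  sum≢0 h [] ne = ⊥-elim' (ne refl)
    where
    open import Data.Empty using () renaming (⊥-elim to ⊥-elim')
  sum≢0 h (x ∷ xs) ne with h x ℕ.≟ 0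
  ... | no hx≢0 = x , here refl , hx≢0
  ... | yes hx≡0 with sum≢0 h xs (λ e → ne (trans (cong₂ ℕ._+_ hx≡0 e) refl))
  ...   | y , y∈ , hy = y , there y∈ , hy

  mul≢0 : ∀ m n → ¬ (m ℕ.* n ≡ 0) → ¬ (m ≡ 0) × ¬ (n ≡ 0)
  mul≢0 m n ne = (λ e → ne (trans (cong (ℕ._* n) e) refl))
               , (λ e → ne (trans (cong (m ℕ.*_) e) (ℕP.*-zeroʳ m)))

  i+[k-i] : ∀ i k → i ℤ.+ (k - i) ≡ k
  i+[k-i] i k = begin
    i ℤ.+ (k ℤ.+ ℤ.- i)   ≡⟨ ℤP.+-comm i (k ℤ.+ ℤ.- i) ⟩
    (k ℤ.+ ℤ.- i) ℤ.+ i   ≡⟨ ℤP.+-assoc k (ℤ.- i) i ⟩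
    k ℤ.+ (ℤ.- i ℤ.+ i)   ≡⟨ cong (λ x → k ℤ.+ x) (ℤP.+-inverseˡ i) ⟩
    k ℤ.+ + 0             ≡⟨ ℤP.+-identityʳ k ⟩
    k ∎
    where open ≡-Reasoning

-- Convolution on ℤ:  (f ⋆ g)(k) = Σ_{i ∈ ℤ} f(i) g(k - i),
-- the sum being taken over the (repetition-free) support of f.

convFn : FinSupp → FinSupp → ℤ → ℕ
convFn f g k = sum (map (λ i → fn f i ℕ.* fn g (k - i)) (usupp f))

_⋆_ : FinSupp → FinSupp → FinSupp
fn     (f ⋆ g) = convFn f g
supp   (f ⋆ g) = cartesianProductWith ℤ._+_ (supp f) (supp g)
covers (f ⋆ g) k ne with sum≢0 (λ i → fn f i ℕ.* fn g (k - i)) (usupp f) ne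
... | i , i∈ , t≢0 with mul≢0 (fn f i) (fn g (k - i)) t≢0
...   | fi≢0 , gi≢0 =
  subst (_∈ cartesianProductWith ℤ._+_ (supp f) (supp g)) (i+[k-i] i k)
        (∈-cartesianProductWith⁺ ℤ._+_ (∈-deduplicate⁻ ℤ._≟_ (supp f) i∈) (covers g (k - i) gi≢0))

infixl 7 _⋆_

δ₀ : FinSupp
fn δ₀ k with k ℤ.≟ + 0
... | yes _ = 1
... | no  _ = 0
supp δ₀ = + 0 ∷ []
covers δ₀ k ne with k ℤ.≟ + 0
... | yes k≡0 = here k≡0
... | no  _   = ⊥-elim' (ne refl)
  where open import Data.Empty using () renaming (⊥-elim to ⊥-elim')

⋆-big : ∀ {N} → (Fin N → FinSupp) → FinSupp
⋆-big F = foldr _⋆_ δ₀ F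

-- Finite subsets of ℤ, given by a repetition-free list, and indicators.

indicator : List ℤ → FinSupp
fn (indicator A) k with k ∈? A
... | yes _ = 1
... | no  _ = 0
supp (indicator A) = A
covers (indicator A) k ne with k ∈? A
... | yes k∈A = k∈A
... | no  _   = ⊥-elim' (ne refl)
  where open import Data.Empty using () renaming (⊥-elim to ⊥-elim')

sharp : List ℤ → List ℤ
sharp A = map +_ (upTo (length A))

-- Majorization.
-- values f : the values of f on its support (each point once);
-- decreasing f : these values sorted in decreasing order, so that
--   f^[i] is the i-th entry (and 0 beyond the end);
-- topSum f k = Σ_{i=1}^{k} f^[i].

values : FinSupp → List ℕ
values f = map (fn f) (usupp f)

decreasing : FinSupp → List ℕ
decreasing f = reverse (sort (values f))

topSum : FinSupp → ℕ → ℕ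
topSum f k = sum (take k (decreasing f))

totalSum : FinSupp → ℕ
totalSum f = sum (decreasing f)

_≺_ : FinSupp → FinSupp → Set
f ≺ g = (∀ k → 1 ℕ.≤ k → topSum f k ℕ.≤ topSum g k) × totalSum f ≡ totalSum g

infix 4 _≺_

-- Each N-fold convolution is a sum of indicators of "chains", lists without repetitions: the
-- sumset of X (sorted increasingly) with a chain Y (sorted decreasingly) splits into the hooks
-- (x₁ + Y) ∪ ((X ∖ x₁) + y₁), then (x₂ + (Y ∖ y₁)) ∪ ((X ∖ {x₁, x₂}) + y₂), and so on, each
-- without repetitions, and the chain lengths depend only on the sizes |Aᵢ|. As no chain repeats
-- a point, any k points carry at most Σ_C min(k, |C|) of the left-hand side. For the sets Aᵢ^#
-- the chains are intervals with a common centre, so the window of k consecutive integers around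
-- that centre meets each chain C in min(k, |C|) points, and the right-hand side attains the bound.
-- Both sides have total mass Σ_C |C|.

module Submission where

open import Defs
open import Data.Nat using (ℕ; _≤_)
open import Data.Integer using (ℤ)
open import Data.List using (List; [])
open import Data.List.Relation.Unary.Unique.Propositional using (Unique)
open import Data.Fin using (Fin)
open import Relation.Binary.PropositionalEquality using (_≢_)

open import Data.Nat using (zero; suc; pred; _+_; _*_; _⊓_; _∸_; _<_; z≤n; s≤s; _≟_; _≤?_)
import Data.Nat.Properties as NP
open import Data.Nat.ListAction using (sum)
open import Data.Nat.ListAction.Properties using (sum-++; sum-↭)
open import Data.Nat.Tactic.RingSolver using () renaming (solve-∀ to solve-∀ⁿ)
import Data.Integer as Z
open Z using () renaming (+_ to pos; _+_ to _+ᶻ_; _-_ to _-ᶻ_; _<_ to _<ᶻ_; _>_ to _>ᶻ_)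
import Data.Integer.Properties as ZP
open import Data.Integer.Tactic.RingSolver using (solve-∀)
import Data.Fin as F
open import Data.List using (_∷_; _++_; map; take; reverse; length; concatMap; filter; deduplicate; applyUpTo; upTo)
import Data.List.Properties as LP
open import Data.List.Membership.Propositional using (_∈_; _∉_)
import Data.List.Membership.Propositional.Properties as MP
open import Data.List.Membership.DecPropositional Z._≟_ using (_∈?_)
open import Data.List.Relation.Binary.Subset.Propositional using (_⊆_)
open import Data.List.Relation.Binary.Pointwise using (Pointwise-≡⇒≡)
open import Data.List.Relation.Binary.Permutation.Propositional
  using (_↭_; ↭-refl; ↭-reflexive; ↭-sym; ↭-trans; prep; ↭⇒↭ₛ; module PermutationReasoning)
import Data.List.Relation.Binary.Permutation.Propositional.Properties as PP
import Data.List.Relation.Binary.Permutation.Setoid.Properties as PSP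
open import Data.List.Relation.Unary.Any using (here; there)
open import Data.List.Relation.Unary.All as All using (All; []; _∷_)
import Data.List.Relation.Unary.All.Properties as AllP
open import Data.List.Relation.Unary.AllPairs as AP using (AllPairs; []; _∷_)
import Data.List.Relation.Unary.AllPairs.Properties as APP
open import Data.List.Relation.Unary.Linked using (Linked; []; [-]; _∷_)
import Data.List.Relation.Unary.Linked.Properties as LinkP
import Data.List.Relation.Unary.Unique.Propositional.Properties as UP
import Data.List.Relation.Unary.Unique.DecPropositional.Properties Z._≟_ as UDP
open import Data.List.Relation.Unary.Sorted.TotalOrder.Properties using (↗↭↗⇒≋)
open import Relation.Binary.Bundles using (DecTotalOrder)
import Relation.Binary.Properties.DecTotalOrder as DTO
import Data.List.Sort NP.≤-decTotalOrder as SN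
import Data.List.Sort ZP.≤-decTotalOrder as SA
import Data.List.Sort (DTO.≥-decTotalOrder ZP.≤-decTotalOrder) as SD
open import Data.Product using (∃; ∃₂; _×_; _,_; proj₂)
open import Data.Sum using (_⊎_; inj₁; inj₂)
open import Data.Empty using (⊥-elim)
open import Relation.Nullary using (¬_; ¬?; yes; no)
open import Relation.Binary.PropositionalEquality
  using (_≡_; ≢-sym; refl; sym; trans; cong; cong₂; subst; setoid; module ≡-Reasoning)
open import Function using (_∘_)
open import Algebra.Properties.CommutativeSemigroup NP.+-commutativeSemigroup
  using () renaming (interchange to +-interchange)

private
  variable
    A B : Set

sum-map-cong : {f g : A → ℕ} (xs : List A) → (∀ x → x ∈ xs → f x ≡ g x) →
  sum (map f xs) ≡ sum (map g xs)
sum-map-cong []       eq = refl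
sum-map-cong (x ∷ xs) eq = cong₂ _+_ (eq x (here refl)) (sum-map-cong xs (λ y y∈ → eq y (there y∈)))

sum-map-mono : {f g : A → ℕ} (xs : List A) → (∀ x → x ∈ xs → f x ≤ g x) →
  sum (map f xs) ≤ sum (map g xs)
sum-map-mono []       le = z≤n
sum-map-mono (x ∷ xs) le = NP.+-mono-≤ (le x (here refl)) (sum-map-mono xs (λ y y∈ → le y (there y∈)))

sum-map-+ : (f g : A → ℕ) (xs : List A) →
  sum (map (λ x → f x + g x) xs) ≡ sum (map f xs) + sum (map g xs)
sum-map-+ f g []       = refl
sum-map-+ f g (x ∷ xs) = begin
  (f x + g x) + sum (map (λ x → f x + g x) xs)  ≡⟨ cong (f x + g x +_) (sum-map-+ f g xs) ⟩
  (f x + g x) + (sum (map f xs) + sum (map g xs)) ≡⟨ +-interchange (f x) (g x) _ _ ⟩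
  (f x + sum (map f xs)) + (g x + sum (map g xs)) ∎
  where open ≡-Reasoning

sum-map-0 : (xs : List A) → sum (map (λ _ → 0) xs) ≡ 0
sum-map-0 []       = refl
sum-map-0 (x ∷ xs) = sum-map-0 xs

sum-map-1 : (xs : List A) → sum (map (λ _ → 1) xs) ≡ length xs
sum-map-1 []       = refl
sum-map-1 (x ∷ xs) = cong suc (sum-map-1 xs)

sum-map-comm : (f : A → B → ℕ) (xs : List A) (ys : List B) →
  sum (map (λ x → sum (map (f x) ys)) xs) ≡ sum (map (λ y → sum (map (λ x → f x y) xs)) ys)
sum-map-comm f []       ys = sym (sum-map-0 ys)
sum-map-comm f (x ∷ xs) ys = trans (cong (sum (map (f x) ys) +_) (sum-map-comm f xs ys))
  (sym (sum-map-+ (f x) (λ y → sum (map (λ x′ → f x′ y) xs)) ys))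

sum-map-↭ : (f : A → ℕ) {xs ys : List A} → xs ↭ ys → sum (map f xs) ≡ sum (map f ys)
sum-map-↭ f p = sum-↭ (PP.map⁺ f p)

sum-map-concatMap : (f : B → ℕ) (g : A → List B) (xs : List A) →
  sum (map f (concatMap g xs)) ≡ sum (map (λ x → sum (map f (g x))) xs)
sum-map-concatMap f g []       = refl
sum-map-concatMap f g (x ∷ xs) = begin
  sum (map f (g x ++ concatMap g xs))              ≡⟨ cong sum (LP.map-++ f (g x) (concatMap g xs)) ⟩
  sum (map f (g x) ++ map f (concatMap g xs))      ≡⟨ sum-++ (map f (g x)) _ ⟩
  sum (map f (g x)) + sum (map f (concatMap g xs)) ≡⟨ cong (sum (map f (g x)) +_) (sum-map-concatMap f g xs) ⟩
  sum (map f (g x)) + sum (map (λ x → sum (map f (g x))) xs) ∎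
  where open ≡-Reasoning

∈⇒≤-sum-map : (f : A → ℕ) {x : A} (xs : List A) → x ∈ xs → f x ≤ sum (map f xs)
∈⇒≤-sum-map f (y ∷ xs) (here refl) = NP.m≤m+n (f y) _
∈⇒≤-sum-map f (y ∷ xs) (there x∈)  = NP.≤-trans (∈⇒≤-sum-map f xs x∈) (NP.m≤n+m _ (f y))

δ : ℤ → ℤ → ℕ
δ a b with a Z.≟ b
... | yes _ = 1
... | no  _ = 0

δ-≡ : ∀ {a b} → a ≡ b → δ a b ≡ 1
δ-≡ {a} {b} a≡b with a Z.≟ b
... | yes _   = refl
... | no  a≢b = ⊥-elim (a≢b a≡b)

δ-≢ : ∀ {a b} → a ≢ b → δ a b ≡ 0
δ-≢ {a} {b} a≢b with a Z.≟ b
... | yes a≡b = ⊥-elim (a≢b a≡b)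
... | no  _   = refl

δ-cong : ∀ {a b c d} → (a ≡ b → c ≡ d) → (c ≡ d → a ≡ b) → δ a b ≡ δ c d
δ-cong {a} {b} to from with a Z.≟ b
... | yes a≡b = sym (δ-≡ (to a≡b))
... | no  a≢b = sym (δ-≢ (a≢b ∘ from))

δ-comm : ∀ a b → δ a b ≡ δ b a
δ-comm a b = δ-cong sym sym

mult : ℤ → List ℤ → ℕ
mult k ys = sum (map (δ k) ys)

mult-++ : ∀ k xs ys → mult k (xs ++ ys) ≡ mult k xs + mult k ys
mult-++ k xs ys = trans (cong sum (LP.map-++ (δ k) xs ys)) (sum-++ (map (δ k) xs) _)

mult-↭ : ∀ k {xs ys} → xs ↭ ys → mult k xs ≡ mult k ys
mult-↭ k = sum-map-↭ (δ k)

mult-∉ : ∀ {k} ys → k ∉ ys → mult k ys ≡ 0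
mult-∉ []       _  = refl
mult-∉ (y ∷ ys) k∉ = cong₂ _+_ (δ-≢ (k∉ ∘ here)) (mult-∉ ys (k∉ ∘ there))

mult-∈ : ∀ {k} ys → k ∈ ys → 1 ≤ mult k ys
mult-∈     (y ∷ ys) (here k≡y) rewrite δ-≡ k≡y = s≤s z≤n
mult-∈ {k} (y ∷ ys) (there k∈) = NP.≤-trans (mult-∈ ys k∈) (NP.m≤n+m _ (δ k y))

mult-≤1 : ∀ {k} ys → Unique ys → mult k ys ≤ 1
mult-≤1     []       _          = z≤n
mult-≤1 {k} (y ∷ ys) (y∉ ∷ uys) with k Z.≟ y
... | yes refl rewrite mult-∉ ys (AllP.All¬⇒¬Any y∉) = s≤s z≤n
... | no  _    = mult-≤1 ys uys

-- Counts the pairs (x, y) ∈ X × Y with x = y: the size of X ∩ Y when neither list has repetitions.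
∣_∩_∣ : List ℤ → List ℤ → ℕ
∣ X ∩ Y ∣ = sum (map (λ x → mult x Y) X)

∣∩∣-comm : ∀ X Y → ∣ X ∩ Y ∣ ≡ ∣ Y ∩ X ∣
∣∩∣-comm X Y = trans (sum-map-comm δ X Y)
  (sum-map-cong Y (λ y _ → sum-map-cong X (λ x _ → δ-comm x y)))

∣∩∣-↭ʳ : ∀ X {Y Y′} → Y ↭ Y′ → ∣ X ∩ Y ∣ ≡ ∣ X ∩ Y′ ∣
∣∩∣-↭ʳ X Y↭Y′ = sum-map-cong X (λ x _ → mult-↭ x Y↭Y′)

∣∩∣≤length : ∀ X {Y} → Unique Y → ∣ X ∩ Y ∣ ≤ length X
∣∩∣≤length X {Y} uY = NP.≤-trans (sum-map-mono X (λ x _ → mult-≤1 Y uY)) (NP.≤-reflexive (sum-map-1 X))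

∣∩∣≤⊓ : ∀ {X Y} → Unique X → Unique Y → ∣ X ∩ Y ∣ ≤ length X ⊓ length Y
∣∩∣≤⊓ {X} {Y} uX uY = NP.⊓-glb (∣∩∣≤length X uY)
  (subst (_≤ length Y) (∣∩∣-comm Y X) (∣∩∣≤length Y uX))

⊆⇒length≤∣∩∣ : ∀ {X Y} → X ⊆ Y → length X ≤ ∣ X ∩ Y ∣
⊆⇒length≤∣∩∣ {X} {Y} X⊆Y = NP.≤-trans (NP.≤-reflexive (sym (sum-map-1 X)))
  (sum-map-mono X (λ x x∈ → mult-∈ Y (X⊆Y x∈)))

nested⇒⊓≤∣∩∣ : ∀ {X Y} → X ⊆ Y ⊎ Y ⊆ X → length X ⊓ length Y ≤ ∣ X ∩ Y ∣
nested⇒⊓≤∣∩∣ {X} {Y} (inj₁ X⊆Y) = NP.≤-trans (NP.m⊓n≤m (length X) (length Y)) (⊆⇒length≤∣∩∣ X⊆Y)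
nested⇒⊓≤∣∩∣ {X} {Y} (inj₂ Y⊆X) = begin
  length X ⊓ length Y  ≤⟨ NP.m⊓n≤n (length X) (length Y) ⟩
  length Y             ≤⟨ ⊆⇒length≤∣∩∣ Y⊆X ⟩
  ∣ Y ∩ X ∣            ≡⟨ ∣∩∣-comm Y X ⟩
  ∣ X ∩ Y ∣            ∎
  where open NP.≤-Reasoning

-- Sumsets and their decomposition into hooks

[x+y]-x≡y : ∀ x y → (x +ᶻ y) -ᶻ x ≡ y
[x+y]-x≡y = solve-∀

x+[k-x]≡k : ∀ x k → x +ᶻ (k -ᶻ x) ≡ k
x+[k-x]≡k = solve-∀

+ᶻ-cancelˡ : ∀ x {a b} → x +ᶻ a ≡ x +ᶻ b → a ≡ b
+ᶻ-cancelˡ x {a} {b} eq = trans (sym ([x+y]-x≡y x a)) (trans (cong (_-ᶻ x) eq) ([x+y]-x≡y x b))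

+ᶻ-cancelʳ : ∀ y {a b} → a +ᶻ y ≡ b +ᶻ y → a ≡ b
+ᶻ-cancelʳ y {a} {b} eq = +ᶻ-cancelˡ y (trans (ZP.+-comm y a) (trans eq (ZP.+-comm b y)))

δ-shift : ∀ k x y → δ k (x +ᶻ y) ≡ δ (k -ᶻ x) y
δ-shift k x y = δ-cong (λ { refl → [x+y]-x≡y x y }) (λ { refl → sym (x+[k-x]≡k x k) })

mult-map-+ˡ : ∀ k x Y → mult k (map (x +ᶻ_) Y) ≡ mult (k -ᶻ x) Y
mult-map-+ˡ k x Y = trans (cong sum (sym (LP.map-∘ Y))) (sum-map-cong Y (λ y _ → δ-shift k x y))

mult-map-+ʳ : ∀ k y X → mult k (map (_+ᶻ y) X) ≡ sum (map (λ x → δ (k -ᶻ x) y) X)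
mult-map-+ʳ k y X = trans (cong sum (sym (LP.map-∘ X))) (sum-map-cong X (λ x _ → δ-shift k x y))

sumsetMult : List ℤ → List ℤ → ℤ → ℕ
sumsetMult X Y k = sum (map (λ x → mult (k -ᶻ x) Y) X)

sumsetMult-↭ : ∀ {X X′ Y Y′} → X ↭ X′ → Y ↭ Y′ → ∀ k → sumsetMult X Y k ≡ sumsetMult X′ Y′ k
sumsetMult-↭ {X} {X′} {Y} X↭X′ Y↭Y′ k = trans (sum-map-↭ (λ x → mult (k -ᶻ x) Y) X↭X′)
  (sum-map-cong X′ (λ x _ → mult-↭ (k -ᶻ x) Y↭Y′))

-- For X increasing and Y decreasing, x₁ + Y and (X ∖ x₁) + y₁ are disjoint,
-- so every hook is repetition-free.
hooks : List ℤ → List ℤ → List (List ℤ)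
hooks []       _        = []
hooks (_ ∷ _)  []       = []
hooks (x ∷ xs) (y ∷ ys) = (map (x +ᶻ_) (y ∷ ys) ++ map (_+ᶻ y) xs) ∷ hooks xs ys

sumsetMult-hooks : ∀ X Y k → sumsetMult X Y k ≡ sum (map (mult k) (hooks X Y))
sumsetMult-hooks []       Y        k = refl
sumsetMult-hooks (x ∷ xs) []       k = sum-map-0 (x ∷ xs)
sumsetMult-hooks (x ∷ xs) (y ∷ ys) k = begin
  mult (k -ᶻ x) (y ∷ ys) + sum (map (λ x′ → δ (k -ᶻ x′) y + mult (k -ᶻ x′) ys) xs)
    ≡⟨ cong (mult (k -ᶻ x) (y ∷ ys) +_) (sum-map-+ (λ x′ → δ (k -ᶻ x′) y) (λ x′ → mult (k -ᶻ x′) ys) xs) ⟩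
  mult (k -ᶻ x) (y ∷ ys) + (sum (map (λ x′ → δ (k -ᶻ x′) y) xs) + sumsetMult xs ys k)
    ≡⟨ sym (NP.+-assoc (mult (k -ᶻ x) (y ∷ ys)) _ _) ⟩
  (mult (k -ᶻ x) (y ∷ ys) + sum (map (λ x′ → δ (k -ᶻ x′) y) xs)) + sumsetMult xs ys k
    ≡⟨ cong₂ _+_ hook (sumsetMult-hooks xs ys k) ⟩
  mult k (map (x +ᶻ_) (y ∷ ys) ++ map (_+ᶻ y) xs) + sum (map (mult k) (hooks xs ys)) ∎
  where
  open ≡-Reasoning
  hook : mult (k -ᶻ x) (y ∷ ys) + sum (map (λ x′ → δ (k -ᶻ x′) y) xs)
       ≡ mult k (map (x +ᶻ_) (y ∷ ys) ++ map (_+ᶻ y) xs)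
  hook = sym (trans (mult-++ k (map (x +ᶻ_) (y ∷ ys)) _) (cong₂ _+_ (mult-map-+ˡ k x (y ∷ ys)) (mult-map-+ʳ k y xs)))

hooks-unique : ∀ {X Y} → AllPairs _<ᶻ_ X → AllPairs _>ᶻ_ Y → All Unique (hooks X Y)
hooks-unique {[]}     {Y}      _            _            = []
hooks-unique {x ∷ xs} {[]}     _            _            = []
hooks-unique {x ∷ xs} {y ∷ ys} (x< ∷ xs<) (y> ∷ ys>) =
  UP.++⁺ (UP.map⁺ (+ᶻ-cancelˡ x) (AP.map (λ y>y′ → ≢-sym (ZP.<⇒≢ y>y′)) (y> ∷ ys>)))
         (UP.map⁺ (+ᶻ-cancelʳ y) (AP.map ZP.<⇒≢ xs<))
         disjoint
  ∷ hooks-unique xs< ys>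
  where
  ≤y : ∀ {y′} → y′ ∈ y ∷ ys → y′ Z.≤ y
  ≤y (here refl) = ZP.≤-refl
  ≤y (there y′∈) = ZP.<⇒≤ (All.lookup y> y′∈)
  disjoint : ∀ {v} → ¬ (v ∈ map (x +ᶻ_) (y ∷ ys) × v ∈ map (_+ᶻ y) xs)
  disjoint (v∈ˡ , v∈ʳ) with MP.∈-map⁻ (x +ᶻ_) v∈ˡ | MP.∈-map⁻ (_+ᶻ y) v∈ʳ
  ... | y′ , y′∈ , refl | x′ , x′∈ , eq = ZP.<⇒≢ (ZP.+-mono-<-≤ (All.lookup x< x′∈) (≤y y′∈)) eq

hookLengths : ℕ → ℕ → List ℕ
hookLengths zero    _       = []
hookLengths (suc p) zero    = []
hookLengths (suc p) (suc q) = suc q + p ∷ hookLengths p q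

length-hooks : ∀ X Y → map length (hooks X Y) ≡ hookLengths (length X) (length Y)
length-hooks []       Y        = refl
length-hooks (x ∷ xs) []       = refl
length-hooks (x ∷ xs) (y ∷ ys) = cong₂ _∷_
  (trans (LP.length-++ (map (x +ᶻ_) (y ∷ ys)))
         (cong₂ _+_ (LP.length-map (x +ᶻ_) (y ∷ ys)) (LP.length-map (_+ᶻ y) xs)))
  (length-hooks xs ys)

-- Decomposing convolutions of indicators into chains

sort↑ : List ℤ → List ℤ
sort↑ = SA.sort

sort↓ : List ℤ → List ℤ
sort↓ = SD.sort

unique-↭ : ∀ {xs ys : List ℤ} → xs ↭ ys → Unique xs → Unique ys
unique-↭ p = PSP.Unique-resp-↭ (setoid ℤ) (↭⇒↭ₛ p)

sort↑-strict : ∀ {xs} → Unique xs → AllPairs _<ᶻ_ (sort↑ xs)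
sort↑-strict {xs} u = AP.map (λ (x≤y , x≢y) → ZP.≤∧≢⇒< x≤y x≢y)
  (AP.zip (LinkP.Linked⇒AllPairs ZP.≤-trans (SA.sort-↗ xs) , unique-↭ (↭-sym (SA.sort-↭ xs)) u))

sort↓-strict : ∀ {xs} → Unique xs → AllPairs _>ᶻ_ (sort↓ xs)
sort↓-strict {xs} u = AP.map (λ (x≥y , x≢y) → ZP.≤∧≢⇒< x≥y (≢-sym x≢y))
  (AP.zip (LinkP.Linked⇒AllPairs (λ p q → ZP.≤-trans q p) (SD.sort-↗ xs) , unique-↭ (↭-sym (SD.sort-↭ xs)) u))

record Decomposes (f : FinSupp) (Cs : List (List ℤ)) : Set where
  field
    fn≡Σmult : ∀ k → fn f k ≡ sum (map (mult k) Cs)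
open Decomposes

δ₀-decomposes : Decomposes δ₀ ((pos 0 ∷ []) ∷ [])
fn≡Σmult δ₀-decomposes k with k Z.≟ pos 0
... | yes _ = refl
... | no  _ = refl

deduplicate-unique : ∀ {xs} → Unique xs → deduplicate Z._≟_ xs ≡ xs
deduplicate-unique {[]}     _          = refl
deduplicate-unique {x ∷ xs} (x∉ ∷ uxs) rewrite deduplicate-unique uxs =
  cong (x ∷_) (LP.filter-all (¬? ∘ (x Z.≟_)) x∉)

indicator-∈ : ∀ {A i} → i ∈ A → fn (indicator A) i ≡ 1
indicator-∈ {A} {i} i∈ with i ∈? A
... | yes _   = refl
... | no  i∉ = ⊥-elim (i∉ i∈)

indicator-⋆ : ∀ {A} g k → Unique A → fn (indicator A ⋆ g) k ≡ sum (map (λ a → fn g (k -ᶻ a)) A)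
indicator-⋆ {A} g k uA rewrite deduplicate-unique uA =
  sum-map-cong A (λ a a∈ → trans (cong (_* fn g (k -ᶻ a)) (indicator-∈ a∈)) (NP.+-identityʳ _))

indicator-⋆-decomposes : ∀ {A g Cs} → Unique A → Decomposes g Cs →
  Decomposes (indicator A ⋆ g) (concatMap (λ C → hooks (sort↑ A) (sort↓ C)) Cs)
fn≡Σmult (indicator-⋆-decomposes {A} {g} {Cs} uA g≡) k = begin
  fn (indicator A ⋆ g) k                                     ≡⟨ indicator-⋆ g k uA ⟩
  sum (map (λ a → fn g (k -ᶻ a)) A)                          ≡⟨ sum-map-cong A (λ a _ → fn≡Σmult g≡ (k -ᶻ a)) ⟩
  sum (map (λ a → sum (map (mult (k -ᶻ a)) Cs)) A)           ≡⟨ sum-map-comm (λ a → mult (k -ᶻ a)) A Cs ⟩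
  sum (map (λ C → sumsetMult A C k) Cs)                      ≡⟨ sum-map-cong Cs (λ C _ → sorted C) ⟩
  sum (map (λ C → sum (map (mult k) (hooks (sort↑ A) (sort↓ C)))) Cs)
    ≡⟨ sum-map-concatMap (mult k) (λ C → hooks (sort↑ A) (sort↓ C)) Cs ⟨
  sum (map (mult k) (concatMap (λ C → hooks (sort↑ A) (sort↓ C)) Cs)) ∎
  where
  open ≡-Reasoning
  sorted : ∀ C → sumsetMult A C k ≡ sum (map (mult k) (hooks (sort↑ A) (sort↓ C)))
  sorted C = trans (sumsetMult-↭ (↭-sym (SA.sort-↭ A)) (↭-sym (SD.sort-↭ C)) k) (sumsetMult-hooks (sort↑ A) (sort↓ C) k)

chains : ∀ {N} → (Fin N → List ℤ) → List (List ℤ)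
chains {zero}  A = (pos 0 ∷ []) ∷ []
chains {suc N} A = concatMap (λ C → hooks (sort↑ (A F.zero)) (sort↓ C)) (chains (A ∘ F.suc))

chains-decompose : ∀ {N} (A : Fin N → List ℤ) → (∀ i → Unique (A i)) →
  Decomposes (⋆-big (λ i → indicator (A i))) (chains A)
chains-decompose {zero}  A _  = δ₀-decomposes
chains-decompose {suc N} A uA =
  indicator-⋆-decomposes (uA F.zero) (chains-decompose (A ∘ F.suc) (uA ∘ F.suc))

chains-unique : ∀ {N} (A : Fin N → List ℤ) → (∀ i → Unique (A i)) → All Unique (chains A)
chains-unique {zero}  A _  = ([] ∷ []) ∷ []
chains-unique {suc N} A uA = AllP.concat⁺ (AllP.map⁺ (All.map
  (λ uC → hooks-unique (sort↑-strict (uA F.zero)) (sort↓-strict uC)) (chains-unique (A ∘ F.suc) (uA ∘ F.suc))))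

map-length-chains-suc : ∀ X Cs →
  map length (concatMap (λ C → hooks (sort↑ X) (sort↓ C)) Cs) ≡ concatMap (hookLengths (length X)) (map length Cs)
map-length-chains-suc X Cs = begin
  map length (concatMap (λ C → hooks (sort↑ X) (sort↓ C)) Cs)       ≡⟨ LP.map-concatMap length _ Cs ⟩
  concatMap (λ C → map length (hooks (sort↑ X) (sort↓ C))) Cs        ≡⟨ LP.concatMap-cong lengths Cs ⟩
  concatMap (λ C → hookLengths (length X) (length C)) Cs             ≡⟨ LP.concatMap-map (hookLengths (length X)) length Cs ⟨
  concatMap (hookLengths (length X)) (map length Cs)                 ∎
  where
  open ≡-Reasoning
  lengths : ∀ C → map length (hooks (sort↑ X) (sort↓ C)) ≡ hookLengths (length X) (length C)
  lengths C = trans (length-hooks (sort↑ X) (sort↓ C))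
    (cong₂ hookLengths (PP.↭-length (SA.sort-↭ X)) (PP.↭-length (SD.sort-↭ C)))

map-length-chains-cong : ∀ {N} {A B : Fin N → List ℤ} → (∀ i → length (A i) ≡ length (B i)) →
  map length (chains A) ≡ map length (chains B)
map-length-chains-cong {zero}              _ = refl
map-length-chains-cong {suc N} {A} {B} |A|≡|B| = begin
  map length (chains A)                                                ≡⟨ map-length-chains-suc (A F.zero) (chains (A ∘ F.suc)) ⟩
  concatMap (hookLengths (length (A F.zero))) (map length (chains (A ∘ F.suc)))
    ≡⟨ cong₂ (λ n ℓs → concatMap (hookLengths n) ℓs) (|A|≡|B| F.zero) (map-length-chains-cong (|A|≡|B| ∘ F.suc)) ⟩
  concatMap (hookLengths (length (B F.zero))) (map length (chains (B ∘ F.suc)))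
    ≡⟨ map-length-chains-suc (B F.zero) (chains (B ∘ F.suc)) ⟨
  map length (chains B)                                                ∎
  where open ≡-Reasoning

interval : ℕ → ℕ → List ℤ
interval a zero    = []
interval a (suc ℓ) = pos (a + ℓ) ∷ interval a ℓ

ascending : ℕ → ℕ → List ℤ
ascending a zero    = []
ascending a (suc n) = pos a ∷ ascending (suc a) n

length-interval : ∀ a ℓ → length (interval a ℓ) ≡ ℓ
length-interval a zero    = refl
length-interval a (suc ℓ) = cong suc (length-interval a ℓ)

∈-interval⁻ : ∀ a ℓ {z} → z ∈ interval a ℓ → ∃ λ m → z ≡ pos m × a ≤ m × m < a + ℓ
∈-interval⁻ a (suc ℓ) (here refl) = a + ℓ , refl , NP.m≤m+n a ℓ , NP.+-monoʳ-< a (NP.n<1+n ℓ)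
∈-interval⁻ a (suc ℓ) (there z∈) with ∈-interval⁻ a ℓ z∈
... | m , z≡m , a≤m , m< = m , z≡m , a≤m , NP.<-trans m< (NP.+-monoʳ-< a (NP.n<1+n ℓ))

∈-interval⁺ : ∀ a ℓ {m} → a ≤ m → m < a + ℓ → pos m ∈ interval a ℓ
∈-interval⁺ a zero    a≤m m< = ⊥-elim (NP.<⇒≱ (subst (_ <_) (NP.+-identityʳ a) m<) a≤m)
∈-interval⁺ a (suc ℓ) {m} a≤m m< with m ≟ a + ℓ
... | yes refl = here refl
... | no  m≢   = there (∈-interval⁺ a ℓ a≤m (NP.≤∧≢⇒< (NP.≤-pred (subst (m <_) (NP.+-suc a ℓ) m<)) m≢))

interval-⊆ : ∀ {a m b n} → b ≤ a → a + m ≤ b + n → interval a m ⊆ interval b n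
interval-⊆ {a} {m} {b} {n} b≤a a+m≤b+n z∈ with ∈-interval⁻ a m z∈
... | _ , refl , a≤z , z< = ∈-interval⁺ b n (NP.≤-trans b≤a a≤z) (NP.<-≤-trans z< a+m≤b+n)

interval-unique : ∀ a ℓ → Unique (interval a ℓ)
interval-unique a zero    = []
interval-unique a (suc ℓ) = All.tabulate a+ℓ∉ ∷ interval-unique a ℓ
  where
  a+ℓ∉ : ∀ {z} → z ∈ interval a ℓ → pos (a + ℓ) ≢ z
  a+ℓ∉ z∈ a+ℓ≡z with ∈-interval⁻ a ℓ z∈
  ... | m , refl , _ , m< = NP.<-irrefl (sym (ZP.+-injective a+ℓ≡z)) m<

interval-sorted↓ : ∀ a ℓ → Linked (λ x y → y Z.≤ x) (interval a ℓ)
interval-sorted↓ a zero          = []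
interval-sorted↓ a (suc zero)    = [-]
interval-sorted↓ a (suc (suc ℓ)) = Z.+≤+ (NP.+-monoʳ-≤ a (NP.n≤1+n ℓ)) ∷ interval-sorted↓ a (suc ℓ)

ascending-sorted↑ : ∀ a n → Linked Z._≤_ (ascending a n)
ascending-sorted↑ a zero          = []
ascending-sorted↑ a (suc zero)    = [-]
ascending-sorted↑ a (suc (suc n)) = Z.+≤+ (NP.n≤1+n a) ∷ ascending-sorted↑ (suc a) (suc n)

sort↑-≡ : ∀ {xs ys} → Linked Z._≤_ ys → xs ↭ ys → sort↑ xs ≡ ys
sort↑-≡ {xs} ys↗ xs↭ys =
  Pointwise-≡⇒≡ (↗↭↗⇒≋ ZP.≤-totalOrder (SA.sort-↗ xs) ys↗ (↭⇒↭ₛ (↭-trans (SA.sort-↭ xs) xs↭ys)))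

sort↓-≡ : ∀ {xs ys} → Linked (λ x y → y Z.≤ x) ys → xs ↭ ys → sort↓ xs ≡ ys
sort↓-≡ {xs} ys↘ xs↭ys = Pointwise-≡⇒≡
  (↗↭↗⇒≋ (DecTotalOrder.totalOrder (DTO.≥-decTotalOrder ZP.≤-decTotalOrder)) (SD.sort-↗ xs) ys↘
    (↭⇒↭ₛ (↭-trans (SD.sort-↭ xs) xs↭ys)))

map-pos-applyUpTo : ∀ (f : ℕ → ℕ) a n → (∀ i → f i ≡ a + i) → map pos (applyUpTo f n) ≡ ascending a n
map-pos-applyUpTo f a zero    f≡ = refl
map-pos-applyUpTo f a (suc n) f≡ = cong₂ _∷_ (cong pos (trans (f≡ 0) (NP.+-identityʳ a)))
  (map-pos-applyUpTo (f ∘ suc) (suc a) n (λ i → trans (f≡ (suc i)) (NP.+-suc a i)))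

sharp≡ascending : ∀ A → sharp A ≡ ascending 0 (length A)
sharp≡ascending A = map-pos-applyUpTo (λ i → i) 0 (length A) (λ i → refl)

interval-suc : ∀ a ℓ → interval a (suc ℓ) ≡ interval (suc a) ℓ ++ pos a ∷ []
interval-suc a zero    = cong (λ b → pos b ∷ []) (NP.+-identityʳ a)
interval-suc a (suc ℓ) = cong₂ _∷_ (cong pos (NP.+-suc a ℓ)) (interval-suc a ℓ)

interval-++ : ∀ a m n → interval a (n + m) ≡ interval (a + m) n ++ interval a m
interval-++ a m zero    = refl
interval-++ a m (suc n) = cong₂ _∷_ (cong pos (a+[n+m]≡[a+m]+n)) (interval-++ a m n)
  where
  a+[n+m]≡[a+m]+n : a + (n + m) ≡ (a + m) + n
  a+[n+m]≡[a+m]+n = trans (cong (a +_) (NP.+-comm n m)) (sym (NP.+-assoc a m n))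

ascending↭interval : ∀ a n → ascending a n ↭ interval a n
ascending↭interval a zero    = ↭-refl
ascending↭interval a (suc n) = begin
  pos a ∷ ascending (suc a) n       ↭⟨ prep (pos a) (ascending↭interval (suc a) n) ⟩
  pos a ∷ interval (suc a) n        ↭⟨ PP.++-comm (pos a ∷ []) (interval (suc a) n) ⟩
  interval (suc a) n ++ pos a ∷ []  ≡⟨ interval-suc a n ⟨
  interval a (suc n)                ∎
  where open PermutationReasoning

map-+-interval : ∀ a s ℓ → map (pos a +ᶻ_) (interval s ℓ) ≡ interval (a + s) ℓ
map-+-interval a s zero    = refl
map-+-interval a s (suc ℓ) = cong₂ _∷_ (cong pos (sym (NP.+-assoc a s ℓ))) (map-+-interval a s ℓ)

map-+-ascending : ∀ a y n → map (_+ᶻ pos y) (ascending a n) ≡ ascending (a + y) n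
map-+-ascending a y zero    = refl
map-+-ascending a y (suc n) = cong (pos (a + y) ∷_) (map-+-ascending (suc a) y n)

hook-interval : ∀ a s p q →
  map (pos a +ᶻ_) (interval s (suc q)) ++ map (_+ᶻ pos (s + q)) (ascending (suc a) p) ↭ interval (a + s) (suc q + p)
hook-interval a s p q = begin
  map (pos a +ᶻ_) (interval s (suc q)) ++ map (_+ᶻ pos (s + q)) (ascending (suc a) p)
    ≡⟨ cong₂ _++_ (map-+-interval a s (suc q)) (map-+-ascending (suc a) (s + q) p) ⟩
  interval (a + s) (suc q) ++ ascending (suc a + (s + q)) p
    ↭⟨ PP.++⁺ˡ (interval (a + s) (suc q)) (ascending↭interval (suc a + (s + q)) p) ⟩
  interval (a + s) (suc q) ++ interval (suc a + (s + q)) p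
    ≡⟨ cong (λ b → interval (a + s) (suc q) ++ interval b p) (+-shift a s q) ⟩
  interval (a + s) (suc q) ++ interval ((a + s) + suc q) p
    ↭⟨ PP.++-comm (interval (a + s) (suc q)) _ ⟩
  interval ((a + s) + suc q) p ++ interval (a + s) (suc q)
    ≡⟨ interval-++ (a + s) (suc q) p ⟨
  interval (a + s) (p + suc q)
    ≡⟨ cong (interval (a + s)) (NP.+-comm p (suc q)) ⟩
  interval (a + s) (suc q + p) ∎
  where
  open PermutationReasoning
  +-shift : ∀ a s q → suc a + (s + q) ≡ (a + s) + suc q
  +-shift = solve-∀ⁿ

-- C lists the interval [s, s + ℓ) in some order, and s + (s + ℓ) = T fixes the centre.
Centred : ℕ → List ℤ → Set
Centred T C = ∃₂ λ s ℓ → C ↭ interval s ℓ × s + s + ℓ ≡ T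

hooks-centred : ∀ a s p q → All (Centred (pred (a + a + (s + s + q) + p))) (hooks (ascending a p) (interval s q))
hooks-centred a s zero    q       = []
hooks-centred a s (suc p) zero    = []
hooks-centred a s (suc p) (suc q) =
  (a + s , suc q + p , hook-interval a s p q , cong pred (centre a s p q))
  ∷ subst (λ T → All (Centred (pred T)) (hooks (ascending (suc a) p) (interval s q)))
          (centre′ a s p q) (hooks-centred (suc a) s p q)
  where
  centre : ∀ a s p q → suc ((a + s) + (a + s) + (suc q + p)) ≡ a + a + (s + s + suc q) + suc p
  centre = solve-∀ⁿ
  centre′ : ∀ a s p q → suc a + suc a + (s + s + q) + p ≡ a + a + (s + s + suc q) + suc p
  centre′ = solve-∀ⁿ

sharp-chains-centred : ∀ {N} (A : Fin N → List ℤ) → ∃ λ T → All (Centred T) (chains (λ i → sharp (A i)))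
sharp-chains-centred {zero}  A = 1 , (0 , 1 , ↭-refl , refl) ∷ []
sharp-chains-centred {suc N} A with sharp-chains-centred (A ∘ F.suc)
... | T , centred = pred (T + n) , AllP.concat⁺ (AllP.map⁺ (All.map centred-hooks centred))
  where
  n = length (A F.zero)
  centred-hooks : ∀ {C} → Centred T C → All (Centred (pred (T + n))) (hooks (sort↑ (sharp (A F.zero))) (sort↓ C))
  centred-hooks (s , ℓ , C↭ , refl)
    rewrite sort↑-≡ (ascending-sorted↑ 0 n) (↭-reflexive (sharp≡ascending (A F.zero)))
          | sort↓-≡ (interval-sorted↓ s ℓ) C↭ = hooks-centred 0 s n ℓ

half-≤ : ∀ x y → x + x ≤ suc (y + y) → x ≤ y
half-≤ zero    y       _  = z≤n
half-≤ (suc x) zero    le = ⊥-elim (NP.<⇒≱ (s≤s (s≤s z≤n)) (subst (_≤ 1) (NP.+-suc (suc x) x) le))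
half-≤ (suc x) (suc y) le rewrite NP.+-suc x x | NP.+-suc y y = s≤s (half-≤ x y (NP.≤-pred (NP.≤-pred le)))

∃-half : ∀ m → ∃ λ c → c + c ≤ m × m ≤ suc (c + c)
∃-half zero          = 0 , z≤n , z≤n
∃-half (suc zero)    = 0 , z≤n , s≤s z≤n
∃-half (suc (suc m)) with ∃-half m
... | c , c+c≤m , m≤ = suc c , subst (_≤ suc (suc m)) c+c+2≡ (s≤s (s≤s c+c≤m))
                            , subst (λ n → suc (suc m) ≤ suc n) c+c+2≡ (s≤s (s≤s m≤))
  where
  c+c+2≡ : suc (suc (c + c)) ≡ suc c + suc c
  c+c+2≡ = cong suc (sym (NP.+-suc c c))

[x+y]+[x+y]≡x+x+y+y : ∀ x y → (x + y) + (x + y) ≡ (x + x + y) + y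
[x+y]+[x+y]≡x+x+y+y = solve-∀ⁿ

-- In doubled coordinates: an interval [b, b + n), n ≤ m, whose centre is within 1/2
-- of that of [a, a + m) lies inside it.
centred-⊆ : ∀ {a m b n} → n ≤ m → a + a + m ≤ suc (b + b + n) → b + b + n ≤ suc (a + a + m) →
  interval b n ⊆ interval a m
centred-⊆ {a} {m} {b} {n} n≤m ≤b ≤a = interval-⊆ a≤b b+n≤a+m
  where
  open NP.≤-Reasoning
  a≤b : a ≤ b
  a≤b = half-≤ a b (NP.+-cancelʳ-≤ m (a + a) (suc (b + b)) (begin
    a + a + m         ≤⟨ ≤b ⟩
    suc (b + b + n)   ≤⟨ s≤s (NP.+-monoʳ-≤ (b + b) n≤m) ⟩
    suc (b + b) + m   ∎))
  b+n≤a+m : b + n ≤ a + m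
  b+n≤a+m = half-≤ (b + n) (a + m) (begin
    (b + n) + (b + n)     ≡⟨ [x+y]+[x+y]≡x+x+y+y b n ⟩
    (b + b + n) + n       ≤⟨ NP.+-mono-≤ ≤a n≤m ⟩
    suc (a + a + m) + m   ≡⟨ cong suc (sym ([x+y]+[x+y]≡x+x+y+y a m)) ⟩
    suc ((a + m) + (a + m)) ∎)

centred-window : ∀ T k → ∃ λ c → ∀ {s ℓ} → s + s + ℓ ≡ T → interval c k ⊆ interval s ℓ ⊎ interval s ℓ ⊆ interval c k
centred-window T k with k ≤? T
... | no  k≰T = 0 , λ {s} {ℓ} s+s+ℓ≡T → inj₂ (interval-⊆ z≤n (begin
  s + ℓ        ≤⟨ NP.m≤n+m (s + ℓ) s ⟩
  s + (s + ℓ)  ≡⟨ trans (sym (NP.+-assoc s s ℓ)) s+s+ℓ≡T ⟩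
  T            ≤⟨ NP.<⇒≤ (NP.≰⇒> k≰T) ⟩
  k            ∎))
  where open NP.≤-Reasoning
... | yes k≤T with ∃-half (T ∸ k)
...   | c , c+c≤ , ≤c+c = c , nested
  where
  [c+c+k]≤T : c + c + k ≤ T
  [c+c+k]≤T = subst (c + c + k ≤_) (NP.m∸n+n≡m k≤T) (NP.+-monoˡ-≤ k c+c≤)
  T≤suc[c+c+k] : T ≤ suc (c + c + k)
  T≤suc[c+c+k] = subst (_≤ suc (c + c + k)) (NP.m∸n+n≡m k≤T) (NP.+-monoˡ-≤ k ≤c+c)
  nested : ∀ {s ℓ} → s + s + ℓ ≡ T → interval c k ⊆ interval s ℓ ⊎ interval s ℓ ⊆ interval c k
  nested {s} {ℓ} refl with k ≤? ℓ
  ... | yes k≤ℓ = inj₁ (centred-⊆ k≤ℓ T≤suc[c+c+k] (NP.m≤n⇒m≤1+n [c+c+k]≤T))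
  ... | no  k≰ℓ = inj₂ (centred-⊆ (NP.<⇒≤ (NP.≰⇒> k≰ℓ)) (NP.m≤n⇒m≤1+n [c+c+k]≤T) T≤suc[c+c+k])

usupp-unique : ∀ f → Unique (usupp f)
usupp-unique f = UDP.deduplicate-! (supp f)

∉-usupp : ∀ f {x} → x ∉ usupp f → fn f x ≡ 0
∉-usupp f {x} x∉ with fn f x ≟ 0
... | yes fx≡0 = fx≡0
... | no  fx≢0 = ⊥-elim (x∉ (MP.∈-deduplicate⁺ Z._≟_ (covers f x fx≢0)))

∈-usupp : ∀ f {x} → 1 ≤ fn f x → x ∈ usupp f
∈-usupp f {x} 1≤fx = MP.∈-deduplicate⁺ Z._≟_ (covers f x (λ fx≡0 → NP.<⇒≢ 1≤fx (sym fx≡0)))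

decreasing↭values : ∀ f → decreasing f ↭ values f
decreasing↭values f = ↭-trans (PP.↭-reverse (SN.sort (values f))) (SN.sort-↭ (values f))

AllPairs-reverse : ∀ {R : A → A → Set} {xs} → AllPairs R xs → AllPairs (λ a b → R b a) (reverse xs)
AllPairs-reverse {xs = []}     []        = []
AllPairs-reverse {xs = x ∷ xs} (x~ ∷ p) rewrite LP.unfold-reverse x xs =
  APP.++⁺ (AllPairs-reverse p) ([] ∷ []) (All.map (_∷ []) (PP.All-resp-↭ (↭-sym (PP.↭-reverse xs)) x~))

decreasing-sorted : ∀ f → AllPairs (λ a b → b ≤ a) (decreasing f)
decreasing-sorted f = AllPairs-reverse (LinkP.Linked⇒AllPairs NP.≤-trans (SN.sort-↗ (values f)))

topSum-attained : ∀ f k → ∃ λ S → Unique S × length S ≤ k × topSum f k ≡ sum (map (fn f) S)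
topSum-attained f k with PP.↭-map-inv (fn f) (↭-sym (decreasing↭values f))
... | U , dec≡ , usupp↭U = take k U , UP.take⁺ k (unique-↭ usupp↭U (usupp-unique f)) , |take|≤k , (begin
  sum (take k (decreasing f)) ≡⟨ cong (sum ∘ take k) dec≡ ⟩
  sum (take k (map (fn f) U)) ≡⟨ cong sum (LP.take-map k U) ⟩
  sum (map (fn f) (take k U)) ∎)
  where
  open ≡-Reasoning
  |take|≤k : length (take k U) ≤ k
  |take|≤k = subst (_≤ k) (sym (LP.length-take k U)) (NP.m⊓n≤m k (length U))

∈⇒↭∷ : ∀ {x : A} {xs} → x ∈ xs → ∃ λ ys → xs ↭ x ∷ ys
∈⇒↭∷ x∈ with MP.∈-∃++ x∈
... | ys , zs , refl = ys ++ zs , PP.shift _ ys zs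

-- If the head d of D occurs in T, drop it from both sides; otherwise it occurs in R, and swapping
-- it with the head t of T increases sum T, since t occurs later in D and so t ≤ d.
sum-≤-sum-take : ∀ {D R : List ℕ} T k → AllPairs (λ a b → b ≤ a) D → D ↭ T ++ R → length T ≤ k →
  sum T ≤ sum (take k D)
sum-≤-sum-take []      k _ _ _ = z≤n
sum-≤-sum-take {[]} (t ∷ T) k _ D↭ _ with PP.↭-empty-inv (↭-sym D↭)
... | ()
sum-≤-sum-take {d ∷ D} {R} (t ∷ T) (suc k) (d≥ ∷ D↘) D↭ (s≤s |T|≤k)
  with MP.∈-++⁻ (t ∷ T) (PP.∈-resp-↭ D↭ (here refl))
... | inj₁ d∈tT with ∈⇒↭∷ d∈tT
...   | T′ , tT↭ = subst (_≤ d + sum (take k D)) (sym (sum-↭ tT↭))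
        (NP.+-monoʳ-≤ d (sum-≤-sum-take T′ k D↘ D↭T′++R |T′|≤k))
  where
  D↭T′++R : D ↭ T′ ++ R
  D↭T′++R = PP.drop-∷ (↭-trans D↭ (PP.++⁺ʳ R tT↭))
  |T′|≤k : length T′ ≤ k
  |T′|≤k = subst (_≤ k) (NP.suc-injective (PP.↭-length tT↭)) |T|≤k
sum-≤-sum-take {d ∷ D} {R} (t ∷ T) (suc k) (d≥ ∷ D↘) D↭ (s≤s |T|≤k)
    | inj₂ d∈R with ∈⇒↭∷ d∈R
...   | R′ , R↭ = NP.+-mono-≤ (All.lookup d≥ t∈D) (sum-≤-sum-take T k D↘ D↭T++tR′ |T|≤k)
  where
  D↭tT++R′ : D ↭ t ∷ T ++ R′
  D↭tT++R′ = PP.drop-∷ (↭-trans D↭ (↭-trans (PP.++⁺ˡ (t ∷ T) R↭) (PP.shift d (t ∷ T) R′)))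
  D↭T++tR′ : D ↭ T ++ t ∷ R′
  D↭T++tR′ = ↭-trans D↭tT++R′ (↭-sym (PP.shift t T R′))
  t∈D : t ∈ D
  t∈D = PP.∈-resp-↭ (↭-sym D↭tT++R′) (here refl)

⊆⇒↭++ : ∀ {S U : List ℤ} → Unique S → Unique U → S ⊆ U → ∃ λ R → U ↭ S ++ R
⊆⇒↭++ {[]}    {U} _          _  _   = U , ↭-refl
⊆⇒↭++ {s ∷ S} {U} (s∉ ∷ uS) uU sS⊆U with ∈⇒↭∷ (sS⊆U (here refl))
... | U′ , U↭ with unique-↭ U↭ uU
...   | _ ∷ uU′ with ⊆⇒↭++ uS uU′ S⊆U′
  where
  S⊆U′ : S ⊆ U′
  S⊆U′ {x} x∈S with PP.∈-resp-↭ U↭ (sS⊆U (there x∈S))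
  ... | here x≡s    = ⊥-elim (All.lookup s∉ x∈S (sym x≡s))
  ... | there x∈U′ = x∈U′
...     | R , U′↭ = R , ↭-trans U↭ (prep s U′↭)

sum-map-filter-∈ : ∀ (h : ℤ → ℕ) U J → (∀ {x} → x ∉ U → h x ≡ 0) →
  sum (map h (filter (_∈? U) J)) ≡ sum (map h J)
sum-map-filter-∈ h U []      h≡0 = refl
sum-map-filter-∈ h U (x ∷ J) h≡0 with x ∈? U
... | yes _   = cong (h x +_) (sum-map-filter-∈ h U J h≡0)
... | no  x∉ = trans (sum-map-filter-∈ h U J h≡0) (cong (_+ sum (map h J)) (sym (h≡0 x∉)))

sum-≤-topSum : ∀ f {J} k → Unique J → length J ≤ k → sum (map (fn f) J) ≤ topSum f k
sum-≤-topSum f {J} k uJ |J|≤k with ⊆⇒↭++ (UP.filter⁺ (_∈? usupp f) uJ) (usupp-unique f)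
                                        (λ x∈ → proj₂ (MP.∈-filter⁻ (_∈? usupp f) {xs = J} x∈))
... | R , usupp↭S++R = begin
  sum (map (fn f) J)              ≡⟨ sum-map-filter-∈ (fn f) (usupp f) J (∉-usupp f) ⟨
  sum (map (fn f) S)              ≤⟨ sum-≤-sum-take (map (fn f) S) k (decreasing-sorted f) dec↭ |S|≤k ⟩
  sum (take k (decreasing f))     ∎
  where
  open NP.≤-Reasoning
  S = filter (_∈? usupp f) J
  dec↭ : decreasing f ↭ map (fn f) S ++ map (fn f) R
  dec↭ = ↭-trans (decreasing↭values f)
           (↭-trans (PP.map⁺ (fn f) usupp↭S++R) (↭-reflexive (LP.map-++ (fn f) S R)))
  |S|≤k : length (map (fn f) S) ≤ k
  |S|≤k = NP.≤-trans (NP.≤-reflexive (LP.length-map (fn f) S)) (NP.≤-trans (LP.length-filter (_∈? usupp f) J) |J|≤k)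

sum-map-fn : ∀ {f Cs} → Decomposes f Cs → ∀ S → sum (map (fn f) S) ≡ sum (map (λ C → ∣ S ∩ C ∣) Cs)
sum-map-fn {f} {Cs} f≡ S = trans (sum-map-cong S (λ s _ → fn≡Σmult f≡ s)) (sum-map-comm mult S Cs)

topSum-≤ : ∀ {f Cs} k → Decomposes f Cs → All Unique Cs → topSum f k ≤ sum (map (k ⊓_) (map length Cs))
topSum-≤ {f} {Cs} k f≡ uCs with topSum-attained f k
... | S , uS , |S|≤k , top≡ = begin
  topSum f k                          ≡⟨ top≡ ⟩
  sum (map (fn f) S)                  ≡⟨ sum-map-fn f≡ S ⟩
  sum (map (λ C → ∣ S ∩ C ∣) Cs)      ≤⟨ sum-map-mono Cs (λ C C∈ → ∣S∩C∣≤ (All.lookup uCs C∈)) ⟩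
  sum (map (λ C → k ⊓ length C) Cs)   ≡⟨ cong sum (LP.map-∘ Cs) ⟩
  sum (map (k ⊓_) (map length Cs))    ∎
  where
  open NP.≤-Reasoning
  ∣S∩C∣≤ : ∀ {C} → Unique C → ∣ S ∩ C ∣ ≤ k ⊓ length C
  ∣S∩C∣≤ {C} uC = NP.≤-trans (∣∩∣≤⊓ uS uC) (NP.⊓-monoˡ-≤ (length C) |S|≤k)

≤-topSum : ∀ {f Cs T} k → Decomposes f Cs → All (Centred T) Cs → sum (map (k ⊓_) (map length Cs)) ≤ topSum f k
≤-topSum {f} {Cs} {T} k f≡ centred with centred-window T k
... | c , nested = begin
  sum (map (k ⊓_) (map length Cs))    ≡⟨ cong sum (LP.map-∘ Cs) ⟨
  sum (map (λ C → k ⊓ length C) Cs)   ≤⟨ sum-map-mono Cs (λ C C∈ → ⊓≤∣J∩C∣ (All.lookup centred C∈)) ⟩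
  sum (map (λ C → ∣ J ∩ C ∣) Cs)      ≡⟨ sum-map-fn f≡ J ⟨
  sum (map (fn f) J)                  ≤⟨ sum-≤-topSum f k (interval-unique c k) (NP.≤-reflexive (length-interval c k)) ⟩
  topSum f k                          ∎
  where
  open NP.≤-Reasoning
  J = interval c k
  ⊓≤∣J∩C∣ : ∀ {C} → Centred T C → k ⊓ length C ≤ ∣ J ∩ C ∣
  ⊓≤∣J∩C∣ {C} (s , ℓ , C↭ , centre) = begin
    k ⊓ length C                       ≡⟨ cong₂ _⊓_ (length-interval c k) (sym (PP.↭-length C↭)) ⟨
    length J ⊓ length (interval s ℓ)   ≤⟨ nested⇒⊓≤∣∩∣ (nested {s} {ℓ} centre) ⟩
    ∣ J ∩ interval s ℓ ∣               ≡⟨ ∣∩∣-↭ʳ J C↭ ⟨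
    ∣ J ∩ C ∣                          ∎

totalSum-≡ : ∀ {f Cs} → Decomposes f Cs → totalSum f ≡ sum (map length Cs)
totalSum-≡ {f} {Cs} f≡ = begin
  sum (decreasing f)                      ≡⟨ sum-↭ (decreasing↭values f) ⟩
  sum (map (fn f) (usupp f))              ≡⟨ sum-map-fn f≡ (usupp f) ⟩
  sum (map (λ C → ∣ usupp f ∩ C ∣) Cs)    ≡⟨ sum-map-cong Cs (λ C C∈ → ∣usupp∩C∣≡ C∈) ⟩
  sum (map length Cs)                     ∎
  where
  open ≡-Reasoning
  C⊆usupp : ∀ {C} → C ∈ Cs → C ⊆ usupp f
  C⊆usupp {C} C∈ {x} x∈ = ∈-usupp f (NP.≤-trans (mult-∈ C x∈)
    (NP.≤-trans (∈⇒≤-sum-map (mult x) Cs C∈) (NP.≤-reflexive (sym (fn≡Σmult f≡ x)))))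
  ∣usupp∩C∣≡ : ∀ {C} → C ∈ Cs → ∣ usupp f ∩ C ∣ ≡ length C
  ∣usupp∩C∣≡ {C} C∈ = NP.≤-antisym
    (subst (_≤ length C) (∣∩∣-comm C (usupp f)) (∣∩∣≤length C (usupp-unique f)))
    (subst (length C ≤_) (∣∩∣-comm C (usupp f)) (⊆⇒length≤∣∩∣ (C⊆usupp C∈)))

sharp-unique : ∀ A → Unique (sharp A)
sharp-unique A = UP.map⁺ ZP.+-injective (UP.upTo⁺ (length A))

length-sharp : ∀ A → length (sharp A) ≡ length A
length-sharp A = trans (LP.length-map pos (upTo (length A))) (LP.length-upTo (length A))

corollary1p5 : (N : ℕ) → 1 ≤ N → (A : Fin N → List ℤ)
    → (∀ i → Unique (A i)) → (∀ i → A i ≢ [])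
    → ⋆-big (λ i → indicator (A i)) ≺ ⋆-big (λ i → indicator (sharp (A i)))
corollary1p5 N _ A uA _ with sharp-chains-centred A
... | T , centred = topSums , totalSums
  where
  A# = λ i → sharp (A i)
  decA  = chains-decompose A uA
  decA# = chains-decompose A# (sharp-unique ∘ A)
  |chains|≡ : map length (chains A) ≡ map length (chains A#)
  |chains|≡ = map-length-chains-cong {A = A} (sym ∘ length-sharp ∘ A)
  topSums : ∀ k → 1 ≤ k → topSum (⋆-big (λ i → indicator (A i))) k ≤ topSum (⋆-big (λ i → indicator (A# i))) k
  topSums k _ = begin
    topSum (⋆-big (λ i → indicator (A i))) k   ≤⟨ topSum-≤ k decA (chains-unique A uA) ⟩
    sum (map (k ⊓_) (map length (chains A)))   ≡⟨ cong (sum ∘ map (k ⊓_)) |chains|≡ ⟩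
    sum (map (k ⊓_) (map length (chains A#)))  ≤⟨ ≤-topSum k decA# centred ⟩
    topSum (⋆-big (λ i → indicator (A# i))) k  ∎
    where open NP.≤-Reasoning
  totalSums : totalSum (⋆-big (λ i → indicator (A i))) ≡ totalSum (⋆-big (λ i → indicator (A# i)))
  totalSums = trans (totalSum-≡ decA) (trans (cong sum |chains|≡) (sym (totalSum-≡ decA#)))
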